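{- Every countable acyclic digraph is majority $3$-choosable: for every countable acyclic digraph $D$ and every assignment of lists $L(v)$, each consisting of exactly $3$ colours, to the vertices $v\in V(D)$, there is a majority colouring $\chi$ of $D$ with $\chi(v)\in L(v)$ for every $v$.
   Context: For a digraph $D$, a majority colouring is an assignment $\chi$ of colours to vertices such that for every vertex $v$: if $v$ has finite outdegree, at most half of the out-edges $v\to u$ are monochromatic (i.e. $\chi(u)=\chi(v)$); if $v$ has infinite outdegree, $v$ has infinitely many outneighbours $u$ with $\chi(u)\neq\chi(v)$. A digraph is majority $\ell$-choosable if for every system of lists $(L(v))_{v}$ with $|L(v)|=\ell$ there is a majority colouring $\chi$ with $\chi(v)\in L(v)$ for all $v$. A digraph is acyclic if it contains no directed cycle. -}

module Defs where

open import Level using (0ℓ)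
open import Data.Nat using (ℕ; _*_; _≤_)
open import Data.Bool using (Bool; true)
open import Data.Fin using (Fin)
open import Data.List using (List; length; filter)
open import Data.List.Membership.Propositional using (_∈_; _∉_)
open import Data.List.Relation.Unary.Unique.Propositional using (Unique)
open import Data.Product using (Σ; ∃; _×_; proj₁)
open import Function.Definitions using (Injective)
open import Function.Bundles using (_⇔_)
open import Relation.Nullary using (¬_)
open import Relation.Binary.Definitions using (DecidableEquality)
open import Relation.Binary.PropositionalEquality using (_≡_; _≢_)
open import Relation.Binary.Construct.Closure.Transitive using (TransClosure)

record Digraph : Set₁ where
  field
    V : Set
    E : V → V → Bool

open Digraph public

Edge : (D : Digraph) → V D → V D → Set
Edge D v u = E D v u ≡ true

Countable : Digraph → Set
Countable D = Σ (V D → ℕ) λ f → Injective _≡_ _≡_ f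

Acyclic : Digraph → Set
Acyclic D = ∀ v → ¬ TransClosure (Edge D) v v

EnumOut : (D : Digraph) → V D → List (V D) → Set
EnumOut D v xs = Unique xs × (∀ u → (u ∈ xs) ⇔ Edge D v u)

FiniteOut : (D : Digraph) → V D → Set
FiniteOut D v = ∃ λ xs → EnumOut D v xs

IsMajorityColouring : (D : Digraph) {C : Set} → DecidableEquality C →
                      (V D → C) → Set
IsMajorityColouring D {C} _≟_ χ = ∀ v →
  -- finite outdegree: at most half of the out-edges are monochromatic
  (∀ xs → EnumOut D v xs →
     2 * length (filter (λ u → χ u ≟ χ v) xs) ≤ length xs)
  ×
  -- infinite outdegree: infinitely many out-neighbours of a different colour
  (¬ FiniteOut D v →
     ∀ (ys : List (V D)) → ∃ λ u → Edge D v u × χ u ≢ χ v × u ∉ ys)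

ListAssignment : (D : Digraph) → (C : Set) → ℕ → Set
ListAssignment D C ℓ = Σ (V D → Fin ℓ → C) λ L → ∀ v → Injective _≡_ _≡_ (L v)

MajorityChoosable : (D : Digraph) → ℕ → Set₁
MajorityChoosable D ℓ =
  ∀ (C : Set) (_≟_ : DecidableEquality C) (L : ListAssignment D C ℓ) →
  ∃ λ (χ : V D → C) →
    (∀ v → ∃ λ (i : Fin ℓ) → proj₁ L v i ≡ χ v) × IsMajorityColouring D _≟_ χ

-- Index the vertices injectively by ℕ. Every vertex of infinite outdegree designates infinitely many
-- of its out-neighbours, in such a way that each vertex is designated at most once, and only by a
-- vertex of smaller index. Each vertex u keeps two colours of its list that differ from the colour
-- of its designator; a vertex of infinite outdegree always takes the first one (well defined by
-- recursion on the index), so it sees its own colour avoided infinitely often. A vertex of finite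
-- outdegree chooses between its two colours by one bit: the two colours cannot both occur on more
-- than half of its out-neighbours. On a finite set of vertices the bits can be fixed one source at
-- a time, since acyclicity provides a source whose colour no other vertex of the set sees; König's
-- lemma for the binary tree of bit sequences then yields one sequence that works everywhere.

module Submission where

open import Defs
open import Level using (0ℓ)
open import Axiom.ExcludedMiddle using (ExcludedMiddle)
open import Axiom.DoubleNegationElimination using (em⇒dne)
open import Data.Bool using (Bool; true; false; if_then_else_)
open import Data.Fin using (Fin; #_)
open import Data.List using (List; []; _∷_; length; filter; foldr)
open import Data.List.Membership.Propositional using (_∈_; _∉_)
open import Data.List.Membership.Propositional.Properties using (∈-filter⁺)
open import Data.List.Membership.Propositional.Properties.WithK using (unique∧set⇒bag)
open import Data.List.Properties using (filter-notAll)
open import Data.List.Relation.Binary.BagAndSetEquality using (∼bag⇒↭)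
open import Data.List.Relation.Binary.Permutation.Propositional using (_↭_)
open import Data.List.Relation.Binary.Permutation.Propositional.Properties using (↭-length; filter-↭)
open import Data.List.Relation.Unary.All as All using (All; []; _∷_)
open import Data.List.Relation.Unary.AllPairs using ([]; _∷_)
open import Data.List.Relation.Unary.Any as Any using (here; there)
open import Data.List.Relation.Unary.Unique.Propositional using (Unique)
open import Data.Maybe using (Maybe; just; nothing)
open import Data.Nat using (ℕ; zero; suc; _+_; _*_; _≤_; _<_; _⊔_; z≤n; s≤s)
open import Data.Nat.Properties
open import Data.List.Extrema ≤-totalOrder using (argmin; argmin-sel; f[argmin]≤f[⊤]; f[argmin]≤f[xs])
open import Data.Product using (Σ; ∃; _×_; _,_; proj₁; proj₂)
open import Data.Sum using (_⊎_; inj₁; inj₂)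
open import Data.Unit using (⊤; tt)
open import Function.Bundles using (Equivalence; mk⇔; mk↣)
open import Function.Definitions using (Injective)
import Function.Properties.Equivalence as ⇔
open import Relation.Binary.Construct.Closure.Transitive using (TransClosure; [_]; _∷ʳ_)
open import Relation.Binary.Definitions using (DecidableEquality; tri<; tri≈; tri>)
open import Relation.Binary.PropositionalEquality
open import Relation.Nullary using (¬_; Dec; yes; no; does; ¬?; contradiction)
open import Relation.Nullary.Decidable using (via-injection)
open import Relation.Unary using (Pred; Decidable)

¬∀⇒∃¬ : ExcludedMiddle 0ℓ → {A : Set} {P : A → Set} → ¬ (∀ a → P a) → ∃ λ a → ¬ P a
¬∀⇒∃¬ em ¬∀P = em⇒dne em λ ¬∃¬P → ¬∀P λ a → em⇒dne em λ ¬Pa → ¬∃¬P (a , ¬Pa)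

update : {B : Set} → (ℕ → B) → ℕ → B → ℕ → B
update σ k b i with i ≟ k
... | yes _ = b
... | no _ = σ i

update-same : {B : Set} (σ : ℕ → B) (k : ℕ) (b : B) → update σ k b k ≡ b
update-same σ k b with k ≟ k
... | yes _ = refl
... | no k≢k = contradiction refl k≢k

update-other : {B : Set} (σ : ℕ → B) {k : ℕ} (b : B) {i : ℕ} → i ≢ k → update σ k b i ≡ σ i
update-other σ {k} b {i} i≢k with i ≟ k
... | yes i≡k = contradiction i≡k i≢k
... | no _ = refl

m+n≤o⇒2m≤o⊎2n≤o : ∀ {a b n} → a + b ≤ n → 2 * a ≤ n ⊎ 2 * b ≤ n
m+n≤o⇒2m≤o⊎2n≤o {a} {b} {n} a+b≤n with ≤-total a b
... | inj₁ a≤b = inj₁ (begin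
  2 * a  ≡⟨ cong (a +_) (+-identityʳ a) ⟩
  a + a  ≤⟨ +-monoʳ-≤ a a≤b ⟩
  a + b  ≤⟨ a+b≤n ⟩
  n      ∎)
  where open ≤-Reasoning
... | inj₂ b≤a = inj₂ (begin
  2 * b  ≡⟨ cong (b +_) (+-identityʳ b) ⟩
  b + b  ≤⟨ +-monoˡ-≤ b b≤a ⟩
  a + b  ≤⟨ a+b≤n ⟩
  n      ∎)
  where open ≤-Reasoning

module _ {A : Set} {P Q : Pred A 0ℓ} (P? : Decidable P) (Q? : Decidable Q) (P⇒Q : ∀ {a} → P a → Q a) where

  filter-length-mono : ∀ xs → length (filter P? xs) ≤ length (filter Q? xs)
  filter-length-mono [] = z≤n
  filter-length-mono (x ∷ xs) with P? x | Q? x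
  ... | yes _  | yes _  = s≤s (filter-length-mono xs)
  ... | yes Px | no ¬Qx = contradiction (P⇒Q Px) ¬Qx
  ... | no _   | yes _  = m≤n⇒m≤1+n (filter-length-mono xs)
  ... | no _   | no _   = filter-length-mono xs

  filter-length-strict : ∀ {x} xs → x ∈ xs → Q x → ¬ P x → length (filter P? xs) < length (filter Q? xs)
  filter-length-strict (y ∷ xs) (here refl) Qy ¬Py with P? y | Q? y
  ... | yes Py | _      = contradiction Py ¬Py
  ... | no _   | yes _  = s≤s (filter-length-mono xs)
  ... | no _   | no ¬Qy = contradiction Qy ¬Qy
  filter-length-strict (y ∷ xs) (there x∈xs) Qx ¬Px with P? y | Q? y
  ... | yes _  | yes _  = s≤s (filter-length-strict xs x∈xs Qx ¬Px)
  ... | yes Py | no ¬Qy = contradiction (P⇒Q Py) ¬Qy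
  ... | no _   | yes _  = m≤n⇒m≤1+n (filter-length-strict xs x∈xs Qx ¬Px)
  ... | no _   | no _   = filter-length-strict xs x∈xs Qx ¬Px

module Counting {X C : Set} (_≟_ : DecidableEquality C) where

  count : (X → C) → C → List X → ℕ
  count χ c xs = length (filter (λ u → χ u ≟ c) xs)

  count-↭ : ∀ {χ c xs ys} → xs ↭ ys → count χ c xs ≡ count χ c ys
  count-↭ {χ} {c} xs↭ys = ↭-length (filter-↭ (λ u → χ u ≟ c) xs↭ys)

  count-cong : ∀ {χ χ′ c xs} → All (λ u → χ u ≡ χ′ u) xs → count χ c xs ≡ count χ′ c xs
  count-cong [] = refl
  count-cong {χ} {χ′} {c} {x ∷ xs} (χx≡χ′x ∷ eqs) with χ x ≟ c | χ′ x ≟ c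
  ... | yes _   | yes _    = cong suc (count-cong eqs)
  ... | no _    | no _     = count-cong eqs
  ... | yes χx≡c | no χ′x≢c = contradiction (trans (sym χx≡χ′x) χx≡c) χ′x≢c
  ... | no χx≢c  | yes χ′x≡c = contradiction (trans χx≡χ′x χ′x≡c) χx≢c

  count+count≤length : ∀ {c c′} → c ≢ c′ → ∀ χ xs → count χ c xs + count χ c′ xs ≤ length xs
  count+count≤length c≢c′ χ [] = z≤n
  count+count≤length {c} {c′} c≢c′ χ (x ∷ xs) with χ x ≟ c | χ x ≟ c′
  ... | yes χx≡c | yes χx≡c′ = contradiction (trans (sym χx≡c) χx≡c′) c≢c′
  ... | yes _ | no _ = s≤s (count+count≤length c≢c′ χ xs)
  ... | no _  | yes _ = subst (_≤ suc (length xs)) (sym (+-suc _ _)) (s≤s (count+count≤length c≢c′ χ xs))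
  ... | no _  | no _  = m≤n⇒m≤1+n (count+count≤length c≢c′ χ xs)

  minority : ∀ {c c′} → c ≢ c′ → ∀ χ xs → 2 * count χ c xs ≤ length xs ⊎ 2 * count χ c′ xs ≤ length xs
  minority {c} {c′} c≢c′ χ xs = m+n≤o⇒2m≤o⊎2n≤o {count χ c xs} {count χ c′ xs} (count+count≤length c≢c′ χ xs)

module _ {C : Set} (_≟_ : DecidableEquality C) where

  avoiding : (Fin 3 → C) → C → Bool → Fin 3
  avoiding l x b with l (# 0) ≟ x | l (# 1) ≟ x
  ... | yes _ | _     = if b then # 2 else # 1
  ... | no _  | yes _ = if b then # 2 else # 0
  ... | no _  | no _  = if b then # 1 else # 0

  avoiding-distinct : ∀ l x → avoiding l x true ≢ avoiding l x false
  avoiding-distinct l x with l (# 0) ≟ x | l (# 1) ≟ x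
  ... | yes _ | _     = λ ()
  ... | no _  | yes _ = λ ()
  ... | no _  | no _  = λ ()

  avoiding-avoids : ∀ {l} → Injective _≡_ _≡_ l → ∀ x b → l (avoiding l x b) ≢ x
  avoiding-avoids {l} inj x true with l (# 0) ≟ x | l (# 1) ≟ x
  ... | yes l₀≡x | _        = λ l₂≡x → contradiction (inj (trans l₂≡x (sym l₀≡x))) λ ()
  ... | no _     | yes l₁≡x = λ l₂≡x → contradiction (inj (trans l₂≡x (sym l₁≡x))) λ ()
  ... | no _     | no l₁≢x  = l₁≢x
  avoiding-avoids {l} inj x false with l (# 0) ≟ x | l (# 1) ≟ x
  ... | yes l₀≡x | _       = λ l₁≡x → contradiction (inj (trans l₁≡x (sym l₀≡x))) λ ()
  ... | no l₀≢x  | yes _   = l₀≢x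
  ... | no l₀≢x  | no _    = l₀≢x

module _ (em : ExcludedMiddle 0ℓ) {A : Set} {R : A → A → Set} (acyclic : ∀ a → ¬ TransClosure R a a) where

  source : ∀ x xs → ∃ λ z → z ∈ x ∷ xs × (∀ {u} → u ∈ x ∷ xs → ¬ R u z)
  source x xs = z , z∈ , no-edge-into-z
    where
    ancestors : A → ℕ
    ancestors z = length (filter (λ w → em {TransClosure R w z}) (x ∷ xs))

    z : A
    z = argmin ancestors x xs

    z∈ : z ∈ x ∷ xs
    z∈ with argmin-sel ancestors x xs
    ... | inj₁ z≡x = here z≡x
    ... | inj₂ z∈xs = there z∈xs

    z-minimal : ∀ {u} → u ∈ x ∷ xs → ancestors z ≤ ancestors u
    z-minimal (here refl) = f[argmin]≤f[⊤] {f = ancestors} x xs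
    z-minimal (there u∈xs) = All.lookup (f[argmin]≤f[xs] {f = ancestors} x xs) u∈xs

    -- an edge u → z makes u an ancestor of z that is not an ancestor of itself
    no-edge-into-z : ∀ {u} → u ∈ x ∷ xs → ¬ R u z
    no-edge-into-z u∈ Ruz = <⇒≱
      (filter-length-strict (λ w → em) (λ w → em) (_∷ʳ Ruz) (x ∷ xs) u∈ [ Ruz ] (acyclic _))
      (z-minimal u∈)

nextOnDiagonal : ℕ × ℕ → ℕ × ℕ
nextOnDiagonal (zero , m) = (suc m , 0)
nextOnDiagonal (suc k , m) = (k , suc m)

diagonal : ℕ → ℕ × ℕ
diagonal zero = (0 , 0)
diagonal (suc s) = nextOnDiagonal (diagonal s)

private
  Visited : ℕ × ℕ → Set
  Visited p = ∃ λ s → diagonal s ≡ p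

  visited-walk : ∀ j k m → Visited (j + k , m) → Visited (k , j + m)
  visited-walk zero k m visited = visited
  visited-walk (suc j) k m (s , eq) with visited-walk j k (suc m) (suc s , cong nextOnDiagonal eq)
  ... | s′ , eq′ = s′ , trans eq′ (cong (k ,_) (+-suc j m))

  visited-axis : ∀ k → Visited (k , 0)
  visited-axis zero = 0 , refl
  visited-axis (suc k) with visited-walk k 0 0 (subst (λ n → Visited (n , 0)) (sym (+-identityʳ k)) (visited-axis k))
  ... | s , eq = suc s , trans (cong nextOnDiagonal eq) (cong (λ n → suc n , 0) (+-identityʳ k))

diagonal-surjective : ∀ k m → ∃ λ s → diagonal s ≡ (k , m)
diagonal-surjective k m with visited-walk m k 0 (visited-axis (m + k))
... | s , eq = s , trans eq (cong (k ,_) (+-identityʳ m))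

module IndexedSet (em : ExcludedMiddle 0ℓ) {A : Set} (index : A → ℕ) (index-injective : Injective _≡_ _≡_ index) where

  _≟ᴬ_ : DecidableEquality A
  _≟ᴬ_ = via-injection (mk↣ index-injective) _≟_

  below : (A → Set) → ℕ → List A
  below P zero = []
  below P (suc n) with em {∃ λ a → index a ≡ n × P a}
  ... | yes (a , _) = a ∷ below P n
  ... | no _ = below P n

  ∈-below⁻ : ∀ {P u} n → u ∈ below P n → P u × index u < n
  ∈-below⁻ {P} (suc n) u∈ with em {∃ λ a → index a ≡ n × P a} | u∈
  ... | yes (a , index-a≡n , Pa) | here refl = Pa , ≤-reflexive (cong suc index-a≡n)
  ... | yes _ | there u∈′ = let (Pu , u<n) = ∈-below⁻ n u∈′ in Pu , m<n⇒m<1+n u<n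
  ... | no _  | u∈′ = let (Pu , u<n) = ∈-below⁻ n u∈′ in Pu , m<n⇒m<1+n u<n

  ∈-below⁺ : ∀ {P u} n → P u → index u < n → u ∈ below P n
  ∈-below⁺ {P} {u} (suc n) Pu u<sn with em {∃ λ a → index a ≡ n × P a} | index u ≟ n
  ... | yes (a , index-a≡n , _) | yes index-u≡n = here (index-injective (trans index-u≡n (sym index-a≡n)))
  ... | yes _ | no index-u≢n = there (∈-below⁺ n Pu (≤∧≢⇒< (≤-pred u<sn) index-u≢n))
  ... | no ∄a | yes index-u≡n = contradiction (u , index-u≡n , Pu) ∄a
  ... | no _  | no index-u≢n = ∈-below⁺ n Pu (≤∧≢⇒< (≤-pred u<sn) index-u≢n)

  below-unique : ∀ P n → Unique (below P n)
  below-unique P zero = []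
  below-unique P (suc n) with em {∃ λ a → index a ≡ n × P a}
  ... | yes (a , index-a≡n , _) =
        All.tabulate (λ u∈ a≡u → <-irrefl (trans (sym (cong index a≡u)) index-a≡n) (proj₂ (∈-below⁻ n u∈)))
        ∷ below-unique P n
  ... | no _ = below-unique P n

  indexBound : List A → ℕ
  indexBound = foldr (λ a n → suc (index a) ⊔ n) 0

  index<indexBound : ∀ {u xs} → u ∈ xs → index u < indexBound xs
  index<indexBound {xs = x ∷ xs} (here refl) = m≤m⊔n (suc (index x)) (indexBound xs)
  index<indexBound {xs = x ∷ xs} (there u∈xs) = ≤-trans (index<indexBound u∈xs) (m≤n⊔m (suc (index x)) (indexBound xs))

  -- Stages walk through diagonal; at stage s = (k , m) the vertex of index k, if in I, designates
  -- a fresh R-successor whose index exceeds m, the vertex's own index and every earlier choice.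
  module Designation (R : A → A → Set) (I : A → Set)
                     (unbounded : ∀ {a} → I a → ∀ B → ∃ λ u → R a u × B ≤ index u) where

    record Fresh (B m : ℕ) (a u : A) : Set where
      field
        edge : R a u
        above-bound : B ≤ index u
        above-stage : m ≤ index u
        above-designator : index a < index u
        designator : I a

    Candidate : ℕ → Set
    Candidate k = ∃ λ a → index a ≡ k × I a

    choose : (B m : ℕ) {k : ℕ} → Dec (Candidate k) → Maybe (A × A)
    choose B m (yes (a , _ , Ia)) = just (a , proj₁ (unbounded Ia (B ⊔ m ⊔ suc (index a))))
    choose B m (no _) = nothing

    choose-fresh : ∀ B m {k} (d : Dec (Candidate k)) {a u} → choose B m d ≡ just (a , u) → Fresh B m a u
    choose-fresh B m (yes (a , _ , Ia)) refl = record
      { edge = Rau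
      ; above-bound = ≤-trans (m≤m⊔n B m) (≤-trans (m≤m⊔n (B ⊔ m) (suc (index a))) large)
      ; above-stage = ≤-trans (m≤n⊔m B m) (≤-trans (m≤m⊔n (B ⊔ m) (suc (index a))) large)
      ; above-designator = ≤-trans (m≤n⊔m (B ⊔ m) (suc (index a))) large
      ; designator = Ia
      }
      where
      Rau = proj₁ (proj₂ (unbounded Ia (B ⊔ m ⊔ suc (index a))))
      large = proj₂ (proj₂ (unbounded Ia (B ⊔ m ⊔ suc (index a))))

    choose-candidate : ∀ B m {k a} → index a ≡ k → I a → (d : Dec (Candidate k)) → ∃ λ u → choose B m d ≡ just (a , u)
    choose-candidate B m index-a≡k Ia (yes (a′ , index-a′≡k , _)) with index-injective (trans index-a′≡k (sym index-a≡k))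
    ... | refl = _ , refl
    choose-candidate B m index-a≡k Ia (no ∄a) = contradiction (_ , index-a≡k , Ia) ∄a

    nextBound : ℕ → Maybe (A × A) → ℕ
    nextBound B (just (_ , u)) = suc (index u)
    nextBound B nothing = B

    mutual
      witness : ℕ → Maybe (A × A)
      witness s = choose (bound s) (proj₂ (diagonal s)) (em {Candidate (proj₁ (diagonal s))})

      bound : ℕ → ℕ
      bound zero = 0
      bound (suc s) = nextBound (bound s) (witness s)

    witness-fresh : ∀ s {a u} → witness s ≡ just (a , u) → Fresh (bound s) (proj₂ (diagonal s)) a u
    witness-fresh s = choose-fresh _ _ _

    bound-suc : ∀ s → bound s ≤ bound (suc s)
    bound-suc s with witness s in eq
    ... | just (a , u) = m≤n⇒m≤1+n (Fresh.above-bound (witness-fresh s eq))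
    ... | nothing = ≤-refl

    bound-after : ∀ {s a u} → witness s ≡ just (a , u) → bound (suc s) ≡ suc (index u)
    bound-after eq rewrite eq = refl

    bound-mono : ∀ {s s′} → s ≤ s′ → bound s ≤ bound s′
    bound-mono s≤s′ with m≤n⇒m<n∨m≡n s≤s′
    ... | inj₂ refl = ≤-refl
    bound-mono {s′ = suc s′} _ | inj₁ s<ss′ = ≤-trans (bound-mono (≤-pred s<ss′)) (bound-suc s′)

    witness-increasing : ∀ {s s′ a u a′ u′} → s < s′ → witness s ≡ just (a , u) → witness s′ ≡ just (a′ , u′) →
                         index u < index u′
    witness-increasing {s} {s′} {u = u} {u′ = u′} s<s′ eq eq′ = begin
      suc (index u)  ≡⟨ sym (bound-after {s} eq) ⟩
      bound (suc s)  ≤⟨ bound-mono s<s′ ⟩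
      bound s′       ≤⟨ Fresh.above-bound (witness-fresh s′ eq′) ⟩
      index u′       ∎
      where open ≤-Reasoning

    Designates : A → A → Set
    Designates a u = ∃ λ s → witness s ≡ just (a , u)

    designates-edge : ∀ {a u} → Designates a u → R a u
    designates-edge (s , eq) = Fresh.edge (witness-fresh s eq)

    designates-index : ∀ {a u} → Designates a u → index a < index u
    designates-index (s , eq) = Fresh.above-designator (witness-fresh s eq)

    designator-in-I : ∀ {a u} → Designates a u → I a
    designator-in-I (s , eq) = Fresh.designator (witness-fresh s eq)

    designator-unique : ∀ {a a′ u} → Designates a u → Designates a′ u → a ≡ a′
    designator-unique (s , eq) (s′ , eq′) with <-cmp s s′
    ... | tri< s<s′ _ _ = contradiction (witness-increasing s<s′ eq eq′) (<-irrefl refl)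
    ... | tri> _ _ s′<s = contradiction (witness-increasing s′<s eq′ eq) (<-irrefl refl)
    ... | tri≈ _ refl _ with trans (sym eq) eq′
    ... | refl = refl

    designates-fresh : ∀ {a} → I a → ∀ ys → ∃ λ u → Designates a u × u ∉ ys
    designates-fresh {a} Ia ys with diagonal-surjective (index a) (indexBound ys)
    ... | s , diagonal-s≡ with choose-candidate (bound s) (proj₂ (diagonal s)) (cong proj₁ (sym diagonal-s≡)) Ia
                                 (em {Candidate (proj₁ (diagonal s))})
    ... | u , eq = u , (s , eq) , λ u∈ys → <⇒≱ (index<indexBound u∈ys)
                     (subst (_≤ index u) (cong proj₂ diagonal-s≡) (Fresh.above-stage (witness-fresh s eq)))

module Compactness (em : ExcludedMiddle 0ℓ) (P : ℕ → (ℕ → Bool) → Set)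
                   (P-antitone : ∀ {m n σ} → m ≤ n → P n σ → P m σ)
                   (P-satisfiable : ∀ n → ∃ (P n)) where

  _≈[_]_ : (ℕ → Bool) → ℕ → (ℕ → Bool) → Set
  σ ≈[ m ] τ = ∀ i → i < m → σ i ≡ τ i

  Extendable : (ℕ → Bool) → ℕ → Set
  Extendable τ m = ∀ n → ∃ λ σ → σ ≈[ m ] τ × P n σ

  ≈-update : ∀ {σ τ m b} → σ ≈[ m ] τ → σ m ≡ b → σ ≈[ suc m ] update τ m b
  ≈-update {m = m} σ≈τ σm≡b i i<sm with i ≟ m
  ... | yes refl = σm≡b
  ... | no i≢m = σ≈τ i (≤∧≢⇒< (≤-pred i<sm) i≢m)

  extendable-step : ∀ {τ m} → Extendable τ m → ¬ Extendable (update τ m true) (suc m) →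
                    Extendable (update τ m false) (suc m)
  extendable-step {τ} {m} ext ¬ext n with ¬∀⇒∃¬ em ¬ext
  ... | n₁ , ¬ext-n₁ with ext (n ⊔ n₁)
  ... | σ , σ≈τ , Pσ = extend (σ m) refl
    where
    extend : ∀ b → σ m ≡ b → ∃ λ σ′ → σ′ ≈[ suc m ] update τ m false × P n σ′
    extend true σm≡true = contradiction (σ , ≈-update σ≈τ σm≡true , P-antitone (m≤n⊔m n n₁) Pσ) ¬ext-n₁
    extend false σm≡false = σ , ≈-update σ≈τ σm≡false , P-antitone (m≤m⊔n n n₁) Pσ

  prefix : ℕ → ℕ → Bool
  prefix zero = λ _ → false
  prefix (suc m) = update (prefix m) m (does (em {Extendable (update (prefix m) m true) (suc m)}))

  prefix-extendable : ∀ m → Extendable (prefix m) m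
  prefix-extendable zero n = proj₁ (P-satisfiable n) , (λ _ ()) , proj₂ (P-satisfiable n)
  prefix-extendable (suc m) with em {Extendable (update (prefix m) m true) (suc m)}
  ... | yes ext = ext
  ... | no ¬ext = extendable-step (prefix-extendable m) ¬ext

  limit : ℕ → Bool
  limit i = prefix (suc i) i

  prefix-settled : ∀ {i m} → i < m → prefix m i ≡ limit i
  prefix-settled {i} {suc m} i<sm with m≤n⇒m<n∨m≡n (≤-pred i<sm)
  ... | inj₂ refl = refl
  ... | inj₁ i<m = trans (update-other (prefix m) _ (<⇒≢ i<m)) (prefix-settled i<m)

  limit-approximable : ∀ m n → ∃ λ σ → σ ≈[ m ] limit × P n σ
  limit-approximable m n with prefix-extendable m n
  ... | σ , σ≈prefix , Pσ = σ , (λ i i<m → trans (σ≈prefix i i<m) (prefix-settled i<m)) , Pσ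

module MajorityColouring (em : ExcludedMiddle 0ℓ) (D : Digraph) (f : V D → ℕ) (f-injective : Injective _≡_ _≡_ f)
                         (acyclic : Acyclic D) {C : Set} (_≟_ : DecidableEquality C)
                         (L : V D → Fin 3 → C) (L-injective : ∀ v → Injective _≡_ _≡_ (L v)) where

  open IndexedSet em f f-injective renaming (_≟ᴬ_ to _≟ᵥ_)
  open Counting {V D} _≟_

  enumOut-↭ : ∀ {v xs ys} → EnumOut D v xs → EnumOut D v ys → xs ↭ ys
  enumOut-↭ (xs-unique , xs⇔) (ys-unique , ys⇔) =
    ∼bag⇒↭ (unique∧set⇒bag xs-unique ys-unique λ {u} → ⇔.trans (xs⇔ u) (⇔.sym (ys⇔ u)))

  infinite⇒unbounded : ∀ {a} → ¬ FiniteOut D a → ∀ B → ∃ λ u → Edge D a u × B ≤ f u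
  infinite⇒unbounded {a} ¬finite B with em {∃ λ u → Edge D a u × B ≤ f u}
  ... | yes far = far
  ... | no ¬far = contradiction
        (below (Edge D a) B , below-unique (Edge D a) B ,
         λ u → mk⇔ (λ u∈ → proj₁ (∈-below⁻ B u∈)) (λ a→u → ∈-below⁺ B a→u (≰⇒> λ B≤fu → ¬far (u , a→u , B≤fu))))
        ¬finite

  open Designation (Edge D) (λ a → ¬ FiniteOut D a) infinite⇒unbounded

  -- The colour a vertex of infinite outdegree receives, computed with fuel n; it is correct once
  -- n > f v, since a designator has a smaller index than the vertices it designates.
  mutual
    fixedColour : ℕ → V D → C
    fixedColour zero v = L v (# 0)
    fixedColour (suc n) v = L v (avoiding _≟_ (L v) (forbiddenAt n v) false)

    -- An undesignated vertex has nothing to avoid; forbidding its first colour is harmless.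
    forbiddenAt : ℕ → V D → C
    forbiddenAt n u with em {∃ λ a → Designates a u}
    ... | yes (a , _) = fixedColour n a
    ... | no _ = L u (# 0)

  mutual
    fixedColour-stable : ∀ {n m v} → f v < n → f v < m → fixedColour n v ≡ fixedColour m v
    fixedColour-stable {suc n} {suc m} {v} v<n v<m =
      cong (λ x → L v (avoiding _≟_ (L v) x false)) (forbiddenAt-stable (≤-pred v<n) (≤-pred v<m))

    forbiddenAt-stable : ∀ {n m u} → f u ≤ n → f u ≤ m → forbiddenAt n u ≡ forbiddenAt m u
    forbiddenAt-stable {n} {m} {u} u≤n u≤m with em {∃ λ a → Designates a u}
    ... | yes (a , a↝u) = fixedColour-stable (<-≤-trans (designates-index a↝u) u≤n) (<-≤-trans (designates-index a↝u) u≤m)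
    ... | no _ = refl

  forbidden : V D → C
  forbidden u = forbiddenAt (f u) u

  forbidden-designated : ∀ {a u} → Designates a u → forbidden u ≡ fixedColour (f u) a
  forbidden-designated {a} {u} a↝u with em {∃ λ a → Designates a u}
  ... | yes (a′ , a′↝u) = cong (fixedColour (f u)) (designator-unique a′↝u a↝u)
  ... | no ∄a = contradiction (a , a↝u) ∄a

  palette : V D → Bool → C
  palette v b = L v (avoiding _≟_ (L v) (forbidden v) b)

  palette-distinct : ∀ v → palette v true ≢ palette v false
  palette-distinct v eq = avoiding-distinct _≟_ (L v) (forbidden v) (L-injective v eq)

  colour : (ℕ → Bool) → V D → C
  colour σ v with em {FiniteOut D v}
  ... | yes _ = palette v (σ (f v))
  ... | no _ = palette v false

  colour-finite : ∀ σ {v} → FiniteOut D v → colour σ v ≡ palette v (σ (f v))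
  colour-finite σ {v} finite with em {FiniteOut D v}
  ... | yes _ = refl
  ... | no ¬finite = contradiction finite ¬finite

  colour-infinite : ∀ σ {v} → ¬ FiniteOut D v → colour σ v ≡ fixedColour (suc (f v)) v
  colour-infinite σ {v} ¬finite with em {FiniteOut D v}
  ... | yes finite = contradiction finite ¬finite
  ... | no _ = refl

  colour-in-palette : ∀ σ v → ∃ λ b → colour σ v ≡ palette v b
  colour-in-palette σ v with em {FiniteOut D v}
  ... | yes _ = σ (f v) , refl
  ... | no _ = false , refl

  colour-in-list : ∀ σ v → ∃ λ i → L v i ≡ colour σ v
  colour-in-list σ v with colour-in-palette σ v
  ... | b , eq = avoiding _≟_ (L v) (forbidden v) b , sym eq

  colour-local : ∀ {σ σ′ v} → σ (f v) ≡ σ′ (f v) → colour σ v ≡ colour σ′ v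
  colour-local {σ} {σ′} {v} eq with em {FiniteOut D v}
  ... | yes _ = cong (palette v) eq
  ... | no _ = refl

  designates⇒colour≢ : ∀ σ {a u} → Designates a u → colour σ u ≢ colour σ a
  designates⇒colour≢ σ {a} {u} a↝u same with colour-in-palette σ u
  ... | b , colour-u≡ = avoiding-avoids _≟_ (L-injective u) (forbidden u) b (begin
    palette u b                ≡⟨ sym colour-u≡ ⟩
    colour σ u                 ≡⟨ same ⟩
    colour σ a                 ≡⟨ colour-infinite σ (designator-in-I a↝u) ⟩
    fixedColour (suc (f a)) a  ≡⟨ fixedColour-stable ≤-refl (designates-index a↝u) ⟩
    fixedColour (f u) a        ≡⟨ sym (forbidden-designated a↝u) ⟩
    forbidden u                ∎)
    where open ≡-Reasoning

  Majority : (ℕ → Bool) → V D → Set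
  Majority σ v = ∀ xs → EnumOut D v xs → 2 * count (colour σ) (colour σ v) xs ≤ length xs

  majority-from-enum : ∀ {σ v xs} → EnumOut D v xs → 2 * count (colour σ) (colour σ v) xs ≤ length xs → Majority σ v
  majority-from-enum {σ} {v} xs-enum balanced ys ys-enum =
    subst₂ (λ k l → 2 * k ≤ l) (count-↭ xs↭ys) (↭-length xs↭ys) balanced
    where xs↭ys = enumOut-↭ xs-enum ys-enum

  majority-local : ∀ {σ σ′ v} → σ (f v) ≡ σ′ (f v) → (∀ {u} → Edge D v u → σ (f u) ≡ σ′ (f u)) →
                   Majority σ v → Majority σ′ v
  majority-local {σ} {σ′} {v} eq-v eq-out M xs xs-enum = subst (λ k → 2 * k ≤ length xs) same-count (M xs xs-enum)
    where
    same-count : count (colour σ) (colour σ v) xs ≡ count (colour σ′) (colour σ′ v) xs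
    same-count = trans (cong (λ c → count (colour σ) c xs) (colour-local eq-v))
                       (count-cong (All.tabulate λ u∈ → colour-local (eq-out (Equivalence.to (proj₂ xs-enum _) u∈))))

  no-loop : ∀ {v u} → Edge D v u → f u ≢ f v
  no-loop {v} v→u fu≡fv = acyclic v [ subst (Edge D v) (f-injective fu≡fv) v→u ]

  balancingBit : (σ : ℕ → Bool) (z : V D) → (xs : List (V D)) → Σ Bool λ b → 2 * count (colour σ) (palette z b) xs ≤ length xs
  balancingBit σ z xs with minority (palette-distinct z) (colour σ) xs
  ... | inj₁ balanced = true , balanced
  ... | inj₂ balanced = false , balanced

  settle : (ℕ → Bool) → V D → ℕ → Bool
  settle σ z with em {FiniteOut D z}
  ... | yes (xs , _) = update σ (f z) (proj₁ (balancingBit σ z xs))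
  ... | no _ = σ

  settle-other : ∀ σ z {i} → i ≢ f z → settle σ z i ≡ σ i
  settle-other σ z i≢fz with em {FiniteOut D z}
  ... | yes _ = update-other σ _ i≢fz
  ... | no _ = refl

  settle-balances : ∀ σ {z} → FiniteOut D z →
                    ∃ λ xs → EnumOut D z xs × settle σ z (f z) ≡ proj₁ (balancingBit σ z xs)
  settle-balances σ {z} finite with em {FiniteOut D z}
  ... | yes (xs , xs-enum) = xs , xs-enum , update-same σ (f z) _
  ... | no ¬finite = contradiction finite ¬finite

  settle-majority : ∀ σ {z} → FiniteOut D z → Majority (settle σ z) z
  settle-majority σ {z} finite with settle-balances σ finite
  ... | xs , xs-enum , settled-bit =
        majority-from-enum xs-enum (subst (λ k → 2 * k ≤ length xs) same-count (proj₂ (balancingBit σ z xs)))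
    where
    σ′ = settle σ z
    same-count : count (colour σ) (palette z (proj₁ (balancingBit σ z xs))) xs ≡ count (colour σ′) (colour σ′ z) xs
    same-count = begin
      count (colour σ) (palette z (proj₁ (balancingBit σ z xs))) xs
        ≡⟨ cong (λ b → count (colour σ) (palette z b) xs) (sym settled-bit) ⟩
      count (colour σ) (palette z (σ′ (f z))) xs
        ≡⟨ cong (λ c → count (colour σ) c xs) (sym (colour-finite σ′ finite)) ⟩
      count (colour σ) (colour σ′ z) xs
        ≡⟨ count-cong (All.tabulate λ u∈ →
             colour-local (sym (settle-other σ z (no-loop (Equivalence.to (proj₂ xs-enum _) u∈))))) ⟩
      count (colour σ′) (colour σ′ z) xs
        ∎
      where open ≡-Reasoning

  Settled : (ℕ → Bool) → List (V D) → Set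
  Settled σ S = ∀ {v} → v ∈ S → FiniteOut D v → Majority σ v

  others : (z : V D) → Decidable (λ w → w ≢ z)
  others z w = ¬? (w ≟ᵥ z)

  -- Settle a source z of S last: no vertex of S sees z's colour, so nothing settled before is disturbed.
  settledWithin : ∀ n S → length S ≤ n → ∃ λ σ → Settled σ S
  settledWithin _ [] _ = (λ _ → false) , λ ()
  settledWithin (suc n) (x ∷ xs) (s≤s |xs|≤n) with source em acyclic x xs
  ... | z , z∈S , no-edge-into-z with settledWithin n rest |rest|≤n
    where
    rest = filter (others z) (x ∷ xs)
    |rest|≤n : length rest ≤ n
    |rest|≤n = ≤-pred (≤-trans (filter-notAll (others z) (x ∷ xs) (Any.map (λ z≡w w≢z → w≢z (sym z≡w)) z∈S)) (s≤s |xs|≤n))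
  ... | σ , σ-settled = settle σ z , settled
    where
    settled : Settled (settle σ z) (x ∷ xs)
    settled {v} v∈S finite with v ≟ᵥ z
    ... | yes refl = settle-majority σ finite
    ... | no v≢z = majority-local
          (sym (settle-other σ z λ fv≡fz → v≢z (f-injective fv≡fz)))
          (λ v→u → sym (settle-other σ z λ fu≡fz → no-edge-into-z v∈S (subst (Edge D v) (f-injective fu≡fz) v→u)))
          (σ-settled (∈-filter⁺ (others z) v∈S v≢z) finite)

  Good : ℕ → (ℕ → Bool) → Set
  Good n σ = ∀ {v} → f v < n → FiniteOut D v → Majority σ v

  good-antitone : ∀ {m n σ} → m ≤ n → Good n σ → Good m σ
  good-antitone m≤n good v<m = good (<-≤-trans v<m m≤n)

  good-satisfiable : ∀ n → ∃ (Good n)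
  good-satisfiable n with settledWithin _ (below (λ _ → ⊤) n) ≤-refl
  ... | σ , σ-settled = σ , λ v<n → σ-settled (∈-below⁺ n tt v<n)

  open Compactness em Good good-antitone good-satisfiable public using (limit; limit-approximable)

  limit-majority : ∀ {v} → FiniteOut D v → Majority limit v
  limit-majority {v} finite@(xs , xs-enum) with limit-approximable (suc (f v) ⊔ indexBound xs) (suc (f v))
  ... | σ , σ≈limit , good = majority-local
        (σ≈limit _ (m≤m⊔n (suc (f v)) (indexBound xs)))
        (λ v→u → σ≈limit _ (≤-trans (index<indexBound (Equivalence.from (proj₂ xs-enum _) v→u)) (m≤n⊔m (suc (f v)) (indexBound xs))))
        (good ≤-refl finite)

  limit-infinite : ∀ {v} → ¬ FiniteOut D v → ∀ ys → ∃ λ u → Edge D v u × colour limit u ≢ colour limit v × u ∉ ys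
  limit-infinite ¬finite ys with designates-fresh ¬finite ys
  ... | u , v↝u , u∉ys = u , designates-edge v↝u , designates⇒colour≢ limit v↝u , u∉ys

  limit-majority-colouring : IsMajorityColouring D _≟_ (colour limit)
  limit-majority-colouring v = (λ xs xs-enum → limit-majority (xs , xs-enum) xs xs-enum) , limit-infinite

theorem6 : ExcludedMiddle 0ℓ → (D : Defs.Digraph) → Countable D → Acyclic D → MajorityChoosable D 3
theorem6 em D (f , f-injective) acyclic C _≟_ (L , L-injective) =
  colour limit , colour-in-list limit , limit-majority-colouring
  where open MajorityColouring em D f f-injective acyclic _≟_ L L-injective
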